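{- Let $\pi=UUD$ and, for $k\geqslant 0$, let $A_k(x)$ be the generating function, by semilength, of the Dyck paths $P\in\mathcal{D}^{h_\pi,\geqslant}$ with $h_\pi(P)=k$. Then the amplitude of $\pi$ is $r_\pi=2$, and $$A_2(x)=\frac{x^2}{(x-1)(x^2+x-1)},\qquad A_1(x)=0,\qquad A_0(x)=\frac{1}{1-x}.$$
   Context: A Dyck path is a lattice path starting at $(0,0)$, ending on the $x$-axis, never going below it, with steps $U=(1,1)$ and $D=(1,-1)$. A pattern is a factor of consecutive steps; the height of an occurrence is the maximal ordinate reached by its points; $h_\pi(P)$ is the maximal height of an occurrence of $\pi$ in $P$ ($0$ if $\pi$ does not occur). The amplitude $r_\pi$ is the height of $\pi$ viewed as a path in the quarter plane whose lowest point touches the $x$-axis. The set $\mathcal{D}^{h_\pi,\geqslant}$ consists of the empty path together with all Dyck paths $P$ whose first return decomposition $P=U\alpha D\beta$ satisfies $\alpha,\beta\in\mathcal{D}^{h_\pi,\geqslant}$ and $h_\pi(U\alpha D)\geqslant h_\pi(\beta)$ (with $h_\pi(U\alpha D)$ computed on the path $U\alpha D$ alone). -}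

module Defs where

open import Data.Nat as ℕ using (ℕ; zero; suc; _⊔_; _*_; _≥_)
open import Data.Integer as ℤ using (ℤ; +_; -[1+_]; ∣_∣)
open import Data.Bool using (Bool; true; false; if_then_else_; _∧_)
open import Data.List using (List; []; _∷_; _++_; [_]; length; foldr; map)
open import Data.List.Membership.Propositional using (_∈_)
open import Data.List.Relation.Unary.Unique.Propositional using (Unique)
open import Data.Product using (Σ; _×_; _,_)
open import Function.Bundles using (_⇔_)
open import Relation.Binary.PropositionalEquality using (_≡_)

-- Lattice paths with steps U = (1,1), D = (1,-1)

data Step : Set where
  U D : Step

Path : Set
Path = List Step

-- Heights (ℕ version, used for sub-paths of Dyck paths, which never go
-- below the x-axis, so truncated subtraction is exact there)

stepH : ℕ → Step → ℕ
stepH h U = suc h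
stepH h D = ℕ.pred h

heights : ℕ → Path → List ℕ
heights h []       = h ∷ []
heights h (s ∷ p)  = h ∷ heights (stepH h s) p

maxList : List ℕ → ℕ
maxList = foldr _⊔_ 0

stepEq : Step → Step → Bool
stepEq U U = true
stepEq D D = true
stepEq _ _ = false

isPrefix : Path → Path → Bool
isPrefix []      _       = true
isPrefix (_ ∷ _) []      = false
isPrefix (a ∷ p) (b ∷ q) = stepEq a b ∧ isPrefix p q

occHeights : Path → ℕ → Path → List ℕ
occHeights π h P = here ++ rest P
  where
  here : List ℕ
  here = if isPrefix π P then [ maxList (heights h π) ] else []
  rest : Path → List ℕ
  rest []      = []
  rest (s ∷ Q) = occHeights π (stepH h s) Q

hπ : Path → Path → ℕ
hπ π P = maxList (occHeights π 0 P)

-- Amplitude r_π: height of π viewed in the quarter plane with its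
-- lowest point on the x-axis, i.e. (max ordinate) - (min ordinate).

stepZ : ℤ → Step → ℤ
stepZ z U = z ℤ.+ + 1
stepZ z D = z ℤ.- + 1

heightsZ : ℤ → Path → List ℤ
heightsZ z []      = z ∷ []
heightsZ z (s ∷ p) = z ∷ heightsZ (stepZ z s) p

amplitude : Path → ℕ
amplitude π = ∣ foldr ℤ._⊔_ (+ 0) hs ℤ.- foldr ℤ._⊓_ (+ 0) hs ∣
  where hs = heightsZ (+ 0) π

-- The class D^{h_π, ≥}: P = U α D β (first return decomposition, which
-- is forced since α is itself a Dyck path) with α, β in the class and
-- h_π(U α D) ≥ h_π(β).

data Dhπ≥ (π : Path) : Path → Set where
  empty : Dhπ≥ π []
  node  : (α β : Path) → Dhπ≥ π α → Dhπ≥ π β →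
          hπ π (U ∷ α ++ [ D ]) ≥ hπ π β →
          Dhπ≥ π (U ∷ α ++ D ∷ β)

-- Generating function by semilength: A : ℕ → ℕ is the coefficient
-- sequence of the g.f. of paths P ∈ D^{h_π,≥} with h_π(P) = k iff for
-- every n, A n is the cardinality of that (finite) set of paths of
-- semilength n, witnessed by a duplicate-free exhaustive list.

IsGF : Path → ℕ → (ℕ → ℕ) → Set
IsGF π k A = ∀ n → Σ (List Path) λ L →
  Unique L ×
  (∀ P → (P ∈ L) ⇔ (Dhπ≥ π P × length P ≡ 2 * n × hπ π P ≡ k)) ×
  length L ≡ A n

-- Formal power series over ℤ (coefficient sequences) and polynomials
-- (coefficient lists, lowest degree first).

Series : Set
Series = ℕ → ℤ

Poly : Set
Poly = List ℤ

toSeries : (ℕ → ℕ) → Series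
toSeries A n = + A n

coeff : Poly → ℕ → ℤ
coeff []      _       = + 0
coeff (c ∷ _) zero    = c
coeff (_ ∷ p) (suc n) = coeff p n

polyToSeries : Poly → Series
polyToSeries = coeff

_*ₚ_ : Poly → Poly → Poly
[]      *ₚ q = []
(c ∷ p) *ₚ q = addP (map (c ℤ.*_) q) (+ 0 ∷ (p *ₚ q))
  where
  addP : Poly → Poly → Poly
  addP []      r       = r
  addP (a ∷ r) []      = a ∷ r
  addP (a ∷ r) (b ∷ s) = (a ℤ.+ b) ∷ addP r s

_·ₚ_ : Series → Poly → Series
(a ·ₚ p) n = go p n
  where
  go : Poly → ℕ → ℤ
  go []      _       = + 0
  go (c ∷ q) zero    = c ℤ.* a zero
  go (c ∷ q) (suc m) = c ℤ.* a (suc m) ℤ.+ go q m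

_≈ₛ_ : Series → Series → Set
a ≈ₛ b = ∀ n → a n ≡ b n

x : Poly
x = + 0 ∷ + 1 ∷ []

x-1 : Poly
x-1 = -[1+ 0 ] ∷ + 1 ∷ []

x²+x-1 : Poly
x²+x-1 = -[1+ 0 ] ∷ + 1 ∷ + 1 ∷ []

1-x : Poly
1-x = + 1 ∷ -[1+ 0 ] ∷ []

x² : Poly
x² = + 0 ∷ + 0 ∷ + 1 ∷ []

one : Poly
one = + 1 ∷ []

UUD : Path
UUD = U ∷ U ∷ D ∷ []

-- Every occurrence of UUD reaches height at least 2, and a Dyck path avoids UUD only if it is
-- (UD)^n, so h_UUD is never 1.  A member of D^{h,≥} of height ≤ 2 other than (UD)^n starts with
-- the arch U(UD)^{a+1}D: a taller first arch would contain UUD at height ≥ 3, and a first arch UD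
-- (of height 0) forces the rest to have height 0 too.  So the members of height 2 are exactly
-- U(UD)^{a+1}D β with β a member of height ≤ 2.  Counting them through the tails (UD)^a D β of
-- length 2n+1 gives t(n+2) = 1 + t(n) + t(n+1) and c(n+2) = t(n); differencing removes the
-- constant and yields c(n+3) = 2c(n+2) − c(n), i.e. the denominator 1 − 2x + x³.
module Submission where

open import Defs
open import Data.Nat using (ℕ; zero; suc; _+_; _*_; _≤_; _⊔_; z≤n; s≤s)
open import Data.Nat.Properties
  using ( ≤-refl; ≤-reflexive; ≤-trans; n≤1+n; m≤m⊔n; m≤n⊔m; m≥n⇒m⊔n≡m; suc-injective; *-suc
        ; module ≤-Reasoning)
open import Data.Nat.Tactic.RingSolver using () renaming (solve-∀ to ℕ-solve-∀)
open import Data.Bool using (if_then_else_)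
open import Data.Integer as ℤ using (+_; -[1+_])
import Data.Integer.Properties as ℤ
open import Data.Integer.Tactic.RingSolver using () renaming (solve-∀ to ℤ-solve-∀)
open import Data.Empty using (⊥)
open import Data.Product using (Σ; _×_; _,_; proj₁; map₁)
open import Data.Sum using (_⊎_; inj₁; inj₂)
open import Data.List using (List; []; _∷_; _++_; [_]; length; map)
open import Data.List.Properties using (++-assoc; ++-cancelˡ; length-++; length-map; ∷-injectiveʳ)
open import Data.List.Membership.Propositional using (_∈_)
open import Data.List.Membership.Propositional.Properties
  using (∈-map⁺; ∈-map⁻; ∈-++⁺ˡ; ∈-++⁺ʳ; ∈-++⁻)
open import Data.List.Relation.Binary.Disjoint.Propositional using (Disjoint)
open import Data.List.Relation.Unary.Any using (here; there)
import Data.List.Relation.Unary.All as All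
open import Data.List.Relation.Unary.AllPairs using ([]; _∷_)
open import Data.List.Relation.Unary.Unique.Propositional using (Unique)
import Data.List.Relation.Unary.Unique.Propositional.Properties as Unique
open import Function.Bundles using (_⇔_; mk⇔)
open import Relation.Nullary.Negation using (contradiction)
open import Relation.Binary.PropositionalEquality
  using (_≡_; _≢_; refl; sym; trans; cong; cong₂; subst; module ≡-Reasoning)

UD : Path
UD = U ∷ D ∷ []

hUUD-from : ℕ → Path → ℕ
hUUD-from h P = maxList (occHeights UUD h P)

maxList-++ʳ : ∀ xs ys → maxList ys ≤ maxList (xs ++ ys)
maxList-++ʳ []       ys = ≤-refl
maxList-++ʳ (x ∷ xs) ys = ≤-trans (maxList-++ʳ xs ys) (m≤n⊔m x _)

hUUD-from-∷ : ∀ h s r → hUUD-from (stepH h s) r ≤ hUUD-from h (s ∷ r)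
hUUD-from-∷ h s r =
  maxList-++ʳ (if isPrefix UUD (s ∷ r) then [ maxList (heights h UUD) ] else []) _

maxList-heights-UUD : ∀ h → maxList (heights h UUD) ≡ 2 + h
maxList-heights-UUD zero    = refl
maxList-heights-UUD (suc h) = cong suc (maxList-heights-UUD h)

hUUD-from-UUD∷ : ∀ h r → hUUD-from h (U ∷ U ∷ D ∷ r) ≡ 2 + h ⊔ hUUD-from (1 + h) r
hUUD-from-UUD∷ h r = cong (_⊔ hUUD-from (1 + h) r) (maxList-heights-UUD h)

data Flat : Path → Set where
  []   : Flat []
  UD∷_ : ∀ {p} → Flat p → Flat (U ∷ D ∷ p)

data Height2 : Path → Set where
  block : ∀ {α β} → Flat α → Flat β ⊎ Height2 β → Height2 (U ∷ U ∷ D ∷ α ++ D ∷ β)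

Height≤2 : Path → Set
Height≤2 p = Flat p ⊎ Height2 p

flat∩height2 : ∀ {p} → Flat p → Height2 p → ⊥
flat∩height2 []      ()
flat∩height2 (UD∷ _) ()

hUUD-from-flat++ : ∀ {α} → Flat α → ∀ h r → hUUD-from h (α ++ r) ≡ hUUD-from h r
hUUD-from-flat++ []      h r = refl
hUUD-from-flat++ (UD∷ f) h r = hUUD-from-flat++ f h r

hπ-flat : ∀ {p} → Flat p → hπ UUD p ≡ 0
hπ-flat []      = refl
hπ-flat (UD∷ f) = hπ-flat f

mutual
  hπ-height2 : ∀ {p} → Height2 p → hπ UUD p ≡ 2
  hπ-height2 (block {α} {β} f g) = begin
    hπ UUD (U ∷ U ∷ D ∷ α ++ D ∷ β) ≡⟨ hUUD-from-UUD∷ 0 (α ++ D ∷ β) ⟩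
    2 ⊔ hUUD-from 1 (α ++ D ∷ β)    ≡⟨ cong (2 ⊔_) (hUUD-from-flat++ f 1 (D ∷ β)) ⟩
    2 ⊔ hπ UUD β                     ≡⟨ m≥n⇒m⊔n≡m (hπ-height≤2 g) ⟩
    2                                ∎
    where open ≡-Reasoning

  hπ-height≤2 : ∀ {p} → Height≤2 p → hπ UUD p ≤ 2
  hπ-height≤2 (inj₁ f) = ≤-trans (≤-reflexive (hπ-flat f)) z≤n
  hπ-height≤2 (inj₂ t) = ≤-reflexive (hπ-height2 t)

hπ-block : ∀ {α} → Flat α → hπ UUD (U ∷ U ∷ D ∷ α ++ [ D ]) ≡ 2
hπ-block f = hπ-height2 (block f (inj₁ []))

flat⇒Dhπ≥ : ∀ {p} → Flat p → Dhπ≥ UUD p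
flat⇒Dhπ≥ []      = empty
flat⇒Dhπ≥ (UD∷ f) = node [] _ empty (flat⇒Dhπ≥ f) (≤-reflexive (hπ-flat f))

mutual
  height2⇒Dhπ≥ : ∀ {p} → Height2 p → Dhπ≥ UUD p
  height2⇒Dhπ≥ (block {α} {β} f g) =
    node (U ∷ D ∷ α) β (flat⇒Dhπ≥ (UD∷ f)) (height≤2⇒Dhπ≥ g)
      (≤-trans (hπ-height≤2 g) (≤-reflexive (sym (hπ-block f))))

  height≤2⇒Dhπ≥ : ∀ {p} → Height≤2 p → Dhπ≥ UUD p
  height≤2⇒Dhπ≥ (inj₁ f) = flat⇒Dhπ≥ f
  height≤2⇒Dhπ≥ (inj₂ t) = height2⇒Dhπ≥ t

Tall : Path → Set
Tall α = ∀ h r → 2 + h ≤ hUUD-from h (α ++ r)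

tall-UUD∷ : ∀ γ → Tall (U ∷ U ∷ D ∷ γ)
tall-UUD∷ γ h r =
  ≤-trans (m≤m⊔n (2 + h) (hUUD-from (1 + h) (γ ++ r)))
          (≤-reflexive (sym (hUUD-from-UUD∷ h (γ ++ r))))

tall-U∷ : ∀ α γ → Tall α → Tall (U ∷ α ++ γ)
tall-U∷ α γ tα h r = begin
  2 + h                                ≤⟨ ≤-trans (n≤1+n (2 + h)) (tα (1 + h) (γ ++ r)) ⟩
  hUUD-from (1 + h) (α ++ γ ++ r)      ≡⟨ cong (hUUD-from (1 + h)) (sym (++-assoc α γ r)) ⟩
  hUUD-from (1 + h) ((α ++ γ) ++ r)    ≤⟨ hUUD-from-∷ h U ((α ++ γ) ++ r) ⟩
  hUUD-from h (U ∷ (α ++ γ) ++ r)      ∎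
  where open ≤-Reasoning

Dhπ≥⇒flat⊎tall : ∀ {p} → Dhπ≥ UUD p → Flat p ⊎ Tall p
Dhπ≥⇒flat⊎tall empty = inj₁ []
Dhπ≥⇒flat⊎tall (node α β dα dβ _) with Dhπ≥⇒flat⊎tall dα
... | inj₂ tα           = inj₂ (tall-U∷ α (D ∷ β) tα)
... | inj₁ (UD∷_ {α′} _) = inj₂ (tall-UUD∷ (α′ ++ D ∷ β))
... | inj₁ [] with Dhπ≥⇒flat⊎tall dβ
...   | inj₁ fβ = inj₁ (UD∷ fβ)
...   | inj₂ tβ = inj₂ tβ

Dhπ≥⇒height≤2 : ∀ {p} → Dhπ≥ UUD p → hπ UUD p ≤ 2 → Height≤2 p
Dhπ≥⇒height≤2 empty _ = inj₁ []
Dhπ≥⇒height≤2 (node α β dα dβ hα≥hβ) h≤2 with Dhπ≥⇒flat⊎tall dα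
... | inj₂ tα =
  contradiction (≤-trans (tα 1 (D ∷ β)) (≤-trans (hUUD-from-∷ 0 U (α ++ D ∷ β)) h≤2))
    λ { (s≤s (s≤s ())) }
... | inj₁ (UD∷ fα) =
  inj₂ (block fα (Dhπ≥⇒height≤2 dβ (≤-trans hα≥hβ (≤-reflexive (hπ-block fα)))))
... | inj₁ [] with Dhπ≥⇒height≤2 dβ h≤2
...   | inj₁ fβ = inj₁ (UD∷ fβ)
...   | inj₂ tβ = contradiction (subst (_≤ 0) (hπ-height2 tβ) hα≥hβ) λ ()

-- Lengths are indexed by double n rather than 2 * n so that they reduce by pattern matching.
double : ℕ → ℕ
double zero    = 0
double (suc n) = 2 + double n

double≡2* : ∀ n → double n ≡ 2 * n
double≡2* zero    = refl
double≡2* (suc n) = trans (cong (_+_ 2) (double≡2* n)) (sym (*-suc 2 n))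

ud : ℕ → Path
ud zero    = []
ud (suc n) = U ∷ D ∷ ud n

flat-ud : ∀ n → Flat (ud n)
flat-ud zero    = []
flat-ud (suc n) = UD∷ flat-ud n

length-ud : ∀ n → length (ud n) ≡ double n
length-ud zero    = refl
length-ud (suc n) = cong (_+_ 2) (length-ud n)

flat⇒≡ud : ∀ {p} n → Flat p → length p ≡ double n → p ≡ ud n
flat⇒≡ud zero    []      _   = refl
flat⇒≡ud (suc n) (UD∷ f) len = cong (UD ++_) (flat⇒≡ud n f (suc-injective (suc-injective len)))

data Tail : Path → Set where
  tail : ∀ {α β} → Flat α → Height≤2 β → Tail (α ++ D ∷ β)

mutual
  height≤2Paths : ℕ → List Path
  height≤2Paths n = ud n ∷ height2Paths n

  height2Paths : ℕ → List Path
  height2Paths zero          = []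
  height2Paths (suc zero)    = []
  height2Paths (suc (suc n)) = map (UUD ++_) (tailPaths n)

  tailPaths : ℕ → List Path
  tailPaths zero    = map (D ∷_) (height≤2Paths zero)
  tailPaths (suc n) = map (D ∷_) (height≤2Paths (suc n)) ++ map (UD ++_) (tailPaths n)

mutual
  ∈height≤2Paths⁻ : ∀ n {P} → P ∈ height≤2Paths n → Height≤2 P × length P ≡ double n
  ∈height≤2Paths⁻ n (here refl) = inj₁ (flat-ud n) , length-ud n
  ∈height≤2Paths⁻ n (there P∈)  = map₁ inj₂ (∈height2Paths⁻ n P∈)

  ∈height2Paths⁻ : ∀ n {P} → P ∈ height2Paths n → Height2 P × length P ≡ double n
  ∈height2Paths⁻ (suc (suc n)) P∈ with ∈-map⁻ (UUD ++_) P∈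
  ... | _ , Q∈ , refl with ∈tailPaths⁻ n Q∈
  ...   | tail f g , len = block f g , cong (_+_ 3) len

  ∈tailPaths⁻ : ∀ n {P} → P ∈ tailPaths n → Tail P × length P ≡ suc (double n)
  ∈tailPaths⁻ zero    P∈ = ∈D∷height≤2Paths⁻ zero P∈
  ∈tailPaths⁻ (suc n) P∈ with ∈-++⁻ (map (D ∷_) (height≤2Paths (suc n))) P∈
  ... | inj₁ P∈₁ = ∈D∷height≤2Paths⁻ (suc n) P∈₁
  ... | inj₂ P∈₂ = ∈UD∷tailPaths⁻ n P∈₂

  ∈D∷height≤2Paths⁻ : ∀ n {P} → P ∈ map (D ∷_) (height≤2Paths n) →
                      Tail P × length P ≡ suc (double n)
  ∈D∷height≤2Paths⁻ n P∈ with ∈-map⁻ (D ∷_) P∈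
  ... | _ , Q∈ , refl with ∈height≤2Paths⁻ n Q∈
  ...   | g , len = tail [] g , cong suc len

  ∈UD∷tailPaths⁻ : ∀ n {P} → P ∈ map (UD ++_) (tailPaths n) →
                   Tail P × length P ≡ suc (double (suc n))
  ∈UD∷tailPaths⁻ n P∈ with ∈-map⁻ (UD ++_) P∈
  ... | _ , Q∈ , refl with ∈tailPaths⁻ n Q∈
  ...   | tail f g , len = tail (UD∷ f) g , cong (_+_ 2) len

mutual
  ∈height≤2Paths⁺ : ∀ n {P} → Height≤2 P → length P ≡ double n → P ∈ height≤2Paths n
  ∈height≤2Paths⁺ n (inj₁ f) len = here (flat⇒≡ud n f len)
  ∈height≤2Paths⁺ n (inj₂ t) len = there (∈height2Paths⁺ n t len)

  ∈height2Paths⁺ : ∀ n {P} → Height2 P → length P ≡ double n → P ∈ height2Paths n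
  ∈height2Paths⁺ zero          (block f g) ()
  ∈height2Paths⁺ (suc zero)    (block f g) ()
  ∈height2Paths⁺ (suc (suc n)) (block f g) len =
    ∈-map⁺ (UUD ++_)
      (∈tailPaths⁺ n (tail f g) (suc-injective (suc-injective (suc-injective len))))

  ∈tailPaths⁺ : ∀ n {P} → Tail P → length P ≡ suc (double n) → P ∈ tailPaths n
  ∈tailPaths⁺ zero    (tail [] g) len =
    ∈-map⁺ (D ∷_) (∈height≤2Paths⁺ zero g (suc-injective len))
  ∈tailPaths⁺ (suc n) (tail [] g) len =
    ∈-++⁺ˡ (∈-map⁺ (D ∷_) (∈height≤2Paths⁺ (suc n) g (suc-injective len)))
  ∈tailPaths⁺ zero    (tail (UD∷ f) g) ()
  ∈tailPaths⁺ (suc n) (tail (UD∷ f) g) len =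
    ∈-++⁺ʳ (map (D ∷_) (height≤2Paths (suc n)))
      (∈-map⁺ (UD ++_) (∈tailPaths⁺ n (tail f g) (suc-injective (suc-injective len))))

D∷-disjoint-UD++ : ∀ xs ys → Disjoint (map (D ∷_) xs) (map (UD ++_) ys)
D∷-disjoint-UD++ xs ys (P∈₁ , P∈₂) with ∈-map⁻ (D ∷_) P∈₁ | ∈-map⁻ (UD ++_) P∈₂
... | _ , _ , refl | _ , _ , ()

ud∉height2Paths : ∀ n → All.All (ud n ≢_) (height2Paths n)
ud∉height2Paths n = All.tabulate λ Q∈ ud≡Q →
  flat∩height2 (subst Flat ud≡Q (flat-ud n)) (proj₁ (∈height2Paths⁻ n Q∈))

mutual
  height≤2Paths-unique : ∀ n → Unique (height≤2Paths n)
  height≤2Paths-unique n = ud∉height2Paths n ∷ height2Paths-unique n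

  height2Paths-unique : ∀ n → Unique (height2Paths n)
  height2Paths-unique zero          = []
  height2Paths-unique (suc zero)    = []
  height2Paths-unique (suc (suc n)) =
    Unique.map⁺ {f = UUD ++_} (++-cancelˡ UUD _ _) (tailPaths-unique n)

  tailPaths-unique : ∀ n → Unique (tailPaths n)
  tailPaths-unique zero    = Unique.map⁺ {f = D ∷_} ∷-injectiveʳ (height≤2Paths-unique zero)
  tailPaths-unique (suc n) =
    Unique.++⁺ (Unique.map⁺ {f = D ∷_} ∷-injectiveʳ (height≤2Paths-unique (suc n)))
               (Unique.map⁺ {f = UD ++_} (++-cancelˡ UD _ _) (tailPaths-unique n))
               (D∷-disjoint-UD++ (height≤2Paths (suc n)) (tailPaths n))

tailCount : ℕ → ℕ
tailCount n = length (tailPaths n)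

height2Count : ℕ → ℕ
height2Count n = length (height2Paths n)

height2Count-shift : ∀ n → height2Count (2 + n) ≡ tailCount n
height2Count-shift n = length-map (UUD ++_) (tailPaths n)

tailCount-recurrence : ∀ n → tailCount (2 + n) ≡ suc (tailCount n + tailCount (1 + n))
tailCount-recurrence n = begin
  length (map (D ∷_) (height≤2Paths (2 + n)) ++ map (UD ++_) (tailPaths (1 + n)))
    ≡⟨ length-++ (map (D ∷_) (height≤2Paths (2 + n))) ⟩
  length (map (D ∷_) (height≤2Paths (2 + n))) + length (map (UD ++_) (tailPaths (1 + n)))
    ≡⟨ cong₂ _+_ (length-map (D ∷_) (height≤2Paths (2 + n)))
                 (length-map (UD ++_) (tailPaths (1 + n))) ⟩
  suc (height2Count (2 + n)) + tailCount (1 + n)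
    ≡⟨ cong (λ m → suc m + tailCount (1 + n)) (height2Count-shift n) ⟩
  suc (tailCount n + tailCount (1 + n))
    ∎
  where open ≡-Reasoning

differenced-recurrence : (t : ℕ → ℕ) → (∀ n → t (2 + n) ≡ suc (t n + t (1 + n))) →
                         ∀ n → t (3 + n) + t n ≡ 2 * t (2 + n)
differenced-recurrence t rec n = begin
  t (3 + n) + t n                               ≡⟨ cong (_+ t n) (rec (1 + n)) ⟩
  suc (t (1 + n) + t (2 + n)) + t n             ≡⟨ cong (λ m → suc (t (1 + n) + m) + t n) (rec n) ⟩
  suc (t (1 + n) + suc (t n + t (1 + n))) + t n ≡⟨ rearrange (t n) (t (1 + n)) ⟩
  2 * suc (t n + t (1 + n))                     ≡⟨ cong (2 *_) (sym (rec n)) ⟩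
  2 * t (2 + n)                                 ∎
  where
  open ≡-Reasoning
  rearrange : ∀ a b → suc (b + suc (a + b)) + a ≡ 2 * suc (a + b)
  rearrange = ℕ-solve-∀

height2Count-recurrence : ∀ n → height2Count (3 + n) + height2Count n ≡ 2 * height2Count (2 + n)
height2Count-recurrence zero          = refl
height2Count-recurrence (suc zero)    = refl
height2Count-recurrence (suc (suc n)) = begin
  height2Count (5 + n) + height2Count (2 + n)
    ≡⟨ cong₂ _+_ (height2Count-shift (3 + n)) (height2Count-shift n) ⟩
  tailCount (3 + n) + tailCount n
    ≡⟨ differenced-recurrence tailCount tailCount-recurrence n ⟩
  2 * tailCount (2 + n)
    ≡⟨ cong (2 *_) (sym (height2Count-shift (2 + n))) ⟩
  2 * height2Count (4 + n)
    ∎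
  where open ≡-Reasoning

coeff-·-1-2x+x³ : ∀ (a : Series) n →
  (a ·ₚ (x-1 *ₚ x²+x-1)) (3 + n) ≡ a (3 + n) ℤ.- + 2 ℤ.* a (2 + n) ℤ.+ a n
coeff-·-1-2x+x³ a zero    = normalise (a 3) (a 2) (a 1) (a 0)
  where
  normalise : ∀ a₃ a₂ a₁ a₀ →
    + 1 ℤ.* a₃ ℤ.+ (-[1+ 1 ] ℤ.* a₂ ℤ.+ (+ 0 ℤ.* a₁ ℤ.+ + 1 ℤ.* a₀)) ≡ a₃ ℤ.- + 2 ℤ.* a₂ ℤ.+ a₀
  normalise = ℤ-solve-∀
coeff-·-1-2x+x³ a (suc n) = normalise (a (4 + n)) (a (3 + n)) (a (2 + n)) (a (1 + n))
  where
  normalise : ∀ a₃ a₂ a₁ a₀ →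
    + 1 ℤ.* a₃ ℤ.+ (-[1+ 1 ] ℤ.* a₂ ℤ.+ (+ 0 ℤ.* a₁ ℤ.+ (+ 1 ℤ.* a₀ ℤ.+ + 0)))
      ≡ a₃ ℤ.- + 2 ℤ.* a₂ ℤ.+ a₀
  normalise = ℤ-solve-∀

recurrence⇒coeff≡0 : ∀ (a : ℕ → ℕ) n → a (3 + n) + a n ≡ 2 * a (2 + n) →
                      (toSeries a ·ₚ (x-1 *ₚ x²+x-1)) (3 + n) ≡ + 0
recurrence⇒coeff≡0 a n rec = begin
  (toSeries a ·ₚ (x-1 *ₚ x²+x-1)) (3 + n)
    ≡⟨ coeff-·-1-2x+x³ (toSeries a) n ⟩
  + a (3 + n) ℤ.- + 2 ℤ.* + a (2 + n) ℤ.+ + a n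
    ≡⟨ regroup (+ a (3 + n)) (+ a (2 + n)) (+ a n) ⟩
  (+ a (3 + n) ℤ.+ + a n) ℤ.- + 2 ℤ.* + a (2 + n)
    ≡⟨ cong₂ ℤ._-_ (sym (ℤ.pos-+ (a (3 + n)) (a n))) (sym (ℤ.pos-* 2 (a (2 + n)))) ⟩
  + (a (3 + n) + a n) ℤ.- + (2 * a (2 + n))
    ≡⟨ cong (λ m → + m ℤ.- + (2 * a (2 + n))) rec ⟩
  + (2 * a (2 + n)) ℤ.- + (2 * a (2 + n))
    ≡⟨ ℤ.+-inverseʳ (+ (2 * a (2 + n))) ⟩
  + 0
    ∎
  where
  open ≡-Reasoning
  regroup : ∀ u v w → u ℤ.- + 2 ℤ.* v ℤ.+ w ≡ (u ℤ.+ w) ℤ.- + 2 ℤ.* v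
  regroup = ℤ-solve-∀

height2Count-series : (toSeries height2Count ·ₚ (x-1 *ₚ x²+x-1)) ≈ₛ polyToSeries x²
height2Count-series zero                = refl
height2Count-series (suc zero)          = refl
height2Count-series (suc (suc zero))    = refl
height2Count-series (suc (suc (suc n))) =
  recurrence⇒coeff≡0 height2Count n (height2Count-recurrence n)

constant-one-series : (toSeries (λ _ → 1) ·ₚ 1-x) ≈ₛ polyToSeries one
constant-one-series zero          = refl
constant-one-series (suc zero)    = refl
constant-one-series (suc (suc n)) = refl

Dhπ≥-height2⇔ : ∀ n P → P ∈ height2Paths n ⇔ (Dhπ≥ UUD P × length P ≡ 2 * n × hπ UUD P ≡ 2)
Dhπ≥-height2⇔ n P = mk⇔ to from
  where
  to : P ∈ height2Paths n → Dhπ≥ UUD P × length P ≡ 2 * n × hπ UUD P ≡ 2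
  to P∈ with ∈height2Paths⁻ n P∈
  ... | t , len = height2⇒Dhπ≥ t , trans len (double≡2* n) , hπ-height2 t
  from : Dhπ≥ UUD P × length P ≡ 2 * n × hπ UUD P ≡ 2 → P ∈ height2Paths n
  from (d , len , h≡2) with Dhπ≥⇒height≤2 d (≤-reflexive h≡2)
  ... | inj₂ t = ∈height2Paths⁺ n t (trans len (sym (double≡2* n)))
  ... | inj₁ f = contradiction (trans (sym (hπ-flat f)) h≡2) λ ()

gf-height2 : IsGF UUD 2 height2Count
gf-height2 n = height2Paths n , height2Paths-unique n , Dhπ≥-height2⇔ n , refl

gf-height1 : IsGF UUD 1 (λ _ → 0)
gf-height1 n = [] , [] , (λ P → mk⇔ (λ ()) from) , refl
  where
  from : ∀ {P} → Dhπ≥ UUD P × length P ≡ 2 * n × hπ UUD P ≡ 1 → P ∈ []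
  from (d , _ , h≡1) with Dhπ≥⇒height≤2 d (≤-trans (≤-reflexive h≡1) (s≤s z≤n))
  ... | inj₁ f = contradiction (trans (sym h≡1) (hπ-flat f)) λ ()
  ... | inj₂ t = contradiction (trans (sym h≡1) (hπ-height2 t)) λ ()

gf-height0 : IsGF UUD 0 (λ _ → 1)
gf-height0 n = [ ud n ] , All.[] ∷ [] , (λ P → mk⇔ to from) , refl
  where
  to : ∀ {P} → P ∈ [ ud n ] → Dhπ≥ UUD P × length P ≡ 2 * n × hπ UUD P ≡ 0
  to (here refl) =
    flat⇒Dhπ≥ (flat-ud n) , trans (length-ud n) (double≡2* n) , hπ-flat (flat-ud n)
  from : ∀ {P} → Dhπ≥ UUD P × length P ≡ 2 * n × hπ UUD P ≡ 0 → P ∈ [ ud n ]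
  from (d , len , h≡0) with Dhπ≥⇒height≤2 d (≤-trans (≤-reflexive h≡0) z≤n)
  ... | inj₁ f = here (flat⇒≡ud n f (trans len (sym (double≡2* n))))
  ... | inj₂ t = contradiction (trans (sym h≡0) (hπ-height2 t)) λ ()

theorem2 : amplitude UUD ≡ 2
    × (Σ (ℕ → ℕ) λ A → IsGF UUD 2 A × ((toSeries A ·ₚ (x-1 *ₚ x²+x-1)) ≈ₛ polyToSeries x²))
    × (Σ (ℕ → ℕ) λ A → IsGF UUD 1 A × (∀ n → A n ≡ 0))
    × (Σ (ℕ → ℕ) λ A → IsGF UUD 0 A × ((toSeries A ·ₚ 1-x) ≈ₛ polyToSeries one))
theorem2 =
    refl
  , (height2Count , gf-height2 , height2Count-series)
  , ((λ _ → 0) , gf-height1 , λ _ → refl)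
  , ((λ _ → 1) , gf-height0 , constant-one-series)
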